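{- Let $G$ be a graph and $r$ an integer with $0<r\le\Delta(G)$. Let $S\subseteq V(G)$ satisfy: (i) $d(u)\le r$ for all $u\in S$; and (ii) for all distinct $u_1,u_2\in S$, either $u_1u_2\in E(G)$ or there exists $u_3\in S$ with $u_1,u_2\in N_G(u_3)$ (or both). Then $\chi_r(G)\ge|S|$.
   Context: All graphs are simple, connected and undirected; $N_G(v)$ is the open neighborhood, $d(v)=|N_G(v)|$, $\Delta$ the maximum degree. For a coloring $c$ and vertex set $S$, $c(S)=\{c(u):u\in S\}$. For integers $k>0$ and $0<r\le\Delta(G)$ with $r\le k$, a conditional $(k,r)$-coloring of $G$ is a surjective map $c:V(G)\to\{1,\dots,k\}$ such that (C1) $c(u)\ne c(v)$ whenever $uv\in E(G)$, and (C2) $|c(N_G(v))|\ge\min\{d(v),r\}$ for every vertex $v$. $\chi_r(G)$ is the smallest $k$ for which $G$ has a conditional $(k,r)$-coloring. A set $S$ with properties (i) and (ii) is called a Vset-$d2r$. -}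

module Defs where

open import Data.Nat using (ℕ; zero; suc; _≤_; _⊔_; _⊓_)
open import Data.Bool using (Bool; true; false; _∧_; _∨_)
open import Data.Fin using (Fin; zero; suc)
open import Data.Fin.Subset using (Subset; ∣_∣; _∈_)
open import Data.Vec using (tabulate)
open import Data.List using (List; foldr; map; allFin)
open import Data.Product using (Σ; ∃; _×_)
open import Relation.Binary.PropositionalEquality using (_≡_; _≢_)
open import Relation.Nullary.Decidable using (⌊_⌋)

record Graph (n : ℕ) : Set where
  field
    adj     : Fin n → Fin n → Bool
    sym     : ∀ u v → adj u v ≡ adj v u
    irrefl  : ∀ v → adj v v ≡ false

open Graph public

data Reachable {n : ℕ} (G : Graph n) : Fin n → Fin n → Set where
  here  : ∀ {u} → Reachable G u u
  step  : ∀ {u v w} → adj G u v ≡ true → Reachable G v w → Reachable G u w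

-- Connected (the vertex set is nonempty since n = suc m below).
Connected : {n : ℕ} → Graph n → Set
Connected {n} G = ∀ u v → Reachable G u v

N : {n : ℕ} → Graph n → Fin n → Subset n
N G v = tabulate (adj G v)

deg : {n : ℕ} → Graph n → Fin n → ℕ
deg G v = ∣ N G v ∣

Δ : {n : ℕ} → Graph n → ℕ
Δ {n} G = foldr _⊔_ 0 (map (deg G) (allFin n))

anyFin : {n : ℕ} → (Fin n → Bool) → Bool
anyFin {zero}  f = false
anyFin {suc n} f = f zero ∨ anyFin (λ i → f (suc i))

image : {n k : ℕ} → (Fin n → Fin k) → Subset n → Subset k
image {n} {k} c S = tabulate (λ j → anyFin (λ u → Data.Vec.lookup S u ∧ ⌊ c u Data.Fin.≟ j ⌋))

-- Conditional (k,r)-colouring; colours {1,…,k} are represented by Fin k.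
record CondColoring {n : ℕ} (G : Graph n) (k r : ℕ) : Set where
  field
    r≤k        : r ≤ k
    c          : Fin n → Fin k
    surjective : ∀ (j : Fin k) → ∃ λ v → c v ≡ j
    proper     : ∀ u v → adj G u v ≡ true → c u ≢ c v
    condition  : ∀ v → deg G v ⊓ r ≤ ∣ image c (N G v) ∣

-- χ_r(G) ≥ m : every conditional (k,r)-colouring uses at least m colours,
-- i.e. the least such k is ≥ m.
χ≥ : {n : ℕ} → Graph n → ℕ → ℕ → Set
χ≥ G r m = ∀ k → CondColoring G k r → m ≤ k

-- A conditional colouring c is injective on S. Two adjacent vertices of S get
-- different colours by (C1). Two non-adjacent ones have a common neighbour w ∈ S; as
-- d(w) ≤ r, condition (C2) at w says that c takes d(w) = |N(w)| distinct values on N(w),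
-- i.e. c is injective on N(w), so again their colours differ. Hence |S| ≤ k.
module Submission where

open import Defs hiding (sym)
open import Data.Nat using (ℕ; suc; _≤_; _<_; z≤n; s≤s)
open import Data.Nat.Properties using (≤-trans; ≤-reflexive; n≤1+n; m≤n⇒m⊓n≡m; <⇒≱)
open import Data.Bool using (Bool; true; T)
open import Data.Bool.Properties using (T-≡; T-∧; T-∨)
open import Data.Fin using (Fin; zero; suc; _≟_)
open import Data.Fin.Properties using (suc-injective; 0≢1+n)
open import Data.Fin.Subset using (Subset; ∣_∣; _∈_; _∉_; _-_; ⊤; inside; outside)
open import Data.Fin.Subset.Properties
  using (∈⊤; ∣⊤∣≡n; ∣⊥∣≡0; p─⊥≡p; p─q⊆p; Empty-unique; x∈p∧x≢y⇒x∈p-y; x∈p⇒∣p-x∣<∣p∣)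
open import Data.Vec using ([]; _∷_; here; there)
open import Data.Vec.Properties using (lookup∘tabulate; []=⇒lookup; lookup⇒[]=)
open import Data.Product using (∃; _×_; _,_)
open import Data.Sum using (_⊎_; inj₁; inj₂)
open import Function using (_∘_; Equivalence)
open import Relation.Nullary using (¬_; yes; no; contradiction)
open import Relation.Nullary.Decidable using (toWitness)
open import Relation.Binary.PropositionalEquality using (_≡_; _≢_; refl; sym; trans; cong; subst)

private
  variable
    n k : ℕ

InjectiveOn : {A : Set} → (Fin n → A) → Subset n → Set
InjectiveOn f p = ∀ {x y} → x ∈ p → y ∈ p → f x ≡ f y → x ≡ y

MapsInto : (Fin n → Fin k) → Subset n → Subset k → Set
MapsInto f p q = ∀ {x} → x ∈ p → f x ∈ q

SurjectiveOnto : (Fin n → Fin k) → Subset n → Subset k → Set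
SurjectiveOnto f p q = ∀ {y} → y ∈ q → ∃ λ x → x ∈ p × f x ≡ y

∣p∣≤1+∣p-x∣ : (p : Subset n) (x : Fin n) → ∣ p ∣ ≤ suc ∣ p - x ∣
∣p∣≤1+∣p-x∣ (inside  ∷ p) zero    = s≤s (≤-reflexive (cong ∣_∣ (sym (p─⊥≡p p))))
∣p∣≤1+∣p-x∣ (outside ∷ p) zero    = subst (λ q → ∣ p ∣ ≤ suc ∣ q ∣) (sym (p─⊥≡p p)) (n≤1+n _)
∣p∣≤1+∣p-x∣ (inside  ∷ p) (suc x) = s≤s (∣p∣≤1+∣p-x∣ p x)
∣p∣≤1+∣p-x∣ (outside ∷ p) (suc x) = ∣p∣≤1+∣p-x∣ p x

x∉p-x : (p : Subset n) (x : Fin n) → x ∉ p - x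
x∉p-x (_ ∷ p) (suc x) (there x∈p-x) = x∉p-x p x x∈p-x

injectiveOn-tail : {A : Set} {f : Fin (suc n) → A} {s : Bool} {p : Subset n} →
  InjectiveOn f (s ∷ p) → InjectiveOn (f ∘ suc) p
injectiveOn-tail inj x∈p y∈p fx≡fy = suc-injective (inj (there x∈p) (there y∈p) fx≡fy)

injectiveOn⇒∣p∣≤∣q∣ : (f : Fin n → Fin k) (p : Subset n) (q : Subset k) →
  MapsInto f p q → InjectiveOn f p → ∣ p ∣ ≤ ∣ q ∣
injectiveOn⇒∣p∣≤∣q∣ f []            q into inj = z≤n
injectiveOn⇒∣p∣≤∣q∣ f (outside ∷ p) q into inj =
  injectiveOn⇒∣p∣≤∣q∣ (f ∘ suc) p q (into ∘ there) (injectiveOn-tail inj)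
injectiveOn⇒∣p∣≤∣q∣ f (inside  ∷ p) q into inj =
  ≤-trans (s≤s (injectiveOn⇒∣p∣≤∣q∣ (f ∘ suc) p (q - f zero) into-q-f₀ (injectiveOn-tail inj)))
          (x∈p⇒∣p-x∣<∣p∣ (into here))
  where
  into-q-f₀ : MapsInto (f ∘ suc) p (q - f zero)
  into-q-f₀ x∈p = x∈p∧x≢y⇒x∈p-y (into (there x∈p)) (λ eq → 0≢1+n (sym (inj (there x∈p) here eq)))

surjectiveOnto⇒∣q∣≤∣p∣ : (f : Fin n → Fin k) (p : Subset n) (q : Subset k) →
  SurjectiveOnto f p q → ∣ q ∣ ≤ ∣ p ∣
surjectiveOnto⇒∣q∣≤∣p∣ {k = k} f [] q onto =
  ≤-reflexive (trans (cong ∣_∣ (Empty-unique λ (_ , y∈q) → noPreimage (onto y∈q))) (∣⊥∣≡0 k))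
  where
  noPreimage : ∀ {y} → ¬ ∃ λ x → x ∈ [] × f x ≡ y
  noPreimage (() , _)
surjectiveOnto⇒∣q∣≤∣p∣ f (outside ∷ p) q onto = surjectiveOnto⇒∣q∣≤∣p∣ (f ∘ suc) p q onto-tail
  where
  onto-tail : SurjectiveOnto (f ∘ suc) p q
  onto-tail y∈q with onto y∈q
  ... | suc x , there x∈p , fx≡y = x , x∈p , fx≡y
surjectiveOnto⇒∣q∣≤∣p∣ f (inside ∷ p) q onto =
  ≤-trans (∣p∣≤1+∣p-x∣ q (f zero)) (s≤s (surjectiveOnto⇒∣q∣≤∣p∣ (f ∘ suc) p (q - f zero) onto-tail))
  where
  onto-tail : SurjectiveOnto (f ∘ suc) p (q - f zero)
  onto-tail {y} y∈q-f₀ with onto (p─q⊆p q _ y∈q-f₀)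
  ... | zero  , _         , f₀≡y = contradiction (subst (_∈ q - f zero) (sym f₀≡y) y∈q-f₀) (x∉p-x q (f zero))
  ... | suc x , there x∈p , fx≡y = x , x∈p , fx≡y

anyFin-witness : (b : Fin n → Bool) → T (anyFin b) → ∃ λ x → T (b x)
anyFin-witness {suc n} b t with Equivalence.to T-∨ t
... | inj₁ t₀ = zero , t₀
... | inj₂ t₊ with anyFin-witness (b ∘ suc) t₊
...   | x , tx = suc x , tx

surjectiveOnto-image : (f : Fin n → Fin k) (p : Subset n) → SurjectiveOnto f p (image f p)
surjectiveOnto-image f p {y} y∈fp
  with anyFin-witness _ (Equivalence.from T-≡ (trans (sym (lookup∘tabulate _ y)) ([]=⇒lookup y∈fp)))
... | x , t with Equivalence.to T-∧ t
...   | x∈p , fx≟y = x , lookup⇒[]= x p (Equivalence.to T-≡ x∈p) , toWitness fx≟y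

∣p∣≤∣image∣⇒injectiveOn : (f : Fin n → Fin k) (p : Subset n) → ∣ p ∣ ≤ ∣ image f p ∣ → InjectiveOn f p
∣p∣≤∣image∣⇒injectiveOn f p ∣p∣≤∣fp∣ {x} {y} x∈p y∈p fx≡fy with x ≟ y
... | yes x≡y = x≡y
... | no  x≢y = contradiction (surjectiveOnto⇒∣q∣≤∣p∣ f (p - y) (image f p) onto-p-y)
                              (<⇒≱ (≤-trans (x∈p⇒∣p-x∣<∣p∣ y∈p) ∣p∣≤∣fp∣))
  where
  onto-p-y : SurjectiveOnto f (p - y) (image f p)
  onto-p-y z∈fp with surjectiveOnto-image f p z∈fp
  ... | w , w∈p , fw≡z with w ≟ y
  ...   | yes refl = x , x∈p∧x≢y⇒x∈p-y x∈p x≢y , trans fx≡fy fw≡z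
  ...   | no  w≢y  = w , x∈p∧x≢y⇒x∈p-y w∈p w≢y , fw≡z

adj⇒∈N : (G : Graph n) {v u : Fin n} → adj G v u ≡ true → u ∈ N G v
adj⇒∈N G {v} {u} vu = lookup⇒[]= u (N G v) (trans (lookup∘tabulate (adj G v) u) vu)

AdjacentOrCommonNeighbourIn : Graph n → Subset n → Fin n → Fin n → Set
AdjacentOrCommonNeighbourIn G S u₁ u₂ =
  adj G u₁ u₂ ≡ true ⊎ ∃ λ u₃ → u₃ ∈ S × adj G u₃ u₁ ≡ true × adj G u₃ u₂ ≡ true

module _ {G : Graph n} {k r : ℕ} (col : CondColoring G k r) where
  open CondColoring col

  deg≤r⇒injectiveOn-N : ∀ {v} → deg G v ≤ r → InjectiveOn c (N G v)
  deg≤r⇒injectiveOn-N {v} dv≤r = ∣p∣≤∣image∣⇒injectiveOn c (N G v)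
    (subst (_≤ ∣ image c (N G v) ∣) (m≤n⇒m⊓n≡m dv≤r) (condition v))

  injectiveOn-Vset : (S : Subset n) → (∀ u → u ∈ S → deg G u ≤ r) →
    (∀ u₁ u₂ → u₁ ∈ S → u₂ ∈ S → u₁ ≢ u₂ → AdjacentOrCommonNeighbourIn G S u₁ u₂) →
    InjectiveOn c S
  injectiveOn-Vset S degS≤r near {u₁} {u₂} u₁∈S u₂∈S cu₁≡cu₂ with u₁ ≟ u₂
  ... | yes u₁≡u₂ = u₁≡u₂
  ... | no  u₁≢u₂ with near u₁ u₂ u₁∈S u₂∈S u₁≢u₂
  ...   | inj₁ u₁u₂ = contradiction cu₁≡cu₂ (proper u₁ u₂ u₁u₂)
  ...   | inj₂ (u₃ , u₃∈S , u₃u₁ , u₃u₂) =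
    deg≤r⇒injectiveOn-N (degS≤r u₃ u₃∈S) (adj⇒∈N G u₃u₁) (adj⇒∈N G u₃u₂) cu₁≡cu₂

-- Connectivity and the bounds 0 < r ≤ Δ(G) are needed only for χ_r(G) to be defined.
lemma3p1 : ∀ (m : ℕ) (G : Graph (suc m)) → Connected G → (r : ℕ) → 0 < r → r ≤ Δ G →
    (S : Subset (suc m)) →
    (∀ u → u ∈ S → deg G u ≤ r) →
    (∀ u₁ u₂ → u₁ ∈ S → u₂ ∈ S → u₁ ≢ u₂ →
      adj G u₁ u₂ ≡ true ⊎ ∃ λ u₃ → u₃ ∈ S × adj G u₃ u₁ ≡ true × adj G u₃ u₂ ≡ true) →
    χ≥ G r ∣ S ∣
lemma3p1 m G _ r _ _ S degS≤r near k col =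
  subst (∣ S ∣ ≤_) (∣⊤∣≡n k)
    (injectiveOn⇒∣p∣≤∣q∣ c S ⊤ (λ _ → ∈⊤) (injectiveOn-Vset col S degS≤r near))
  where open CondColoring col using (c)
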